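{- Let $G$ and $H$ be bipartite graphs all of whose connected components have at least two vertices. Then $|\mathrm{Hom}(G,T)| = |\mathrm{Hom}(H,T)|$ for every tree $T$ of diameter at most $2$ if, and only if, $\gamma(G) = \gamma(H)$, $\sum_{i=1}^{\gamma(G)} m^G_i = \sum_{i=1}^{\gamma(H)} m^H_i$, and $\mathrm{psum}(\vec{d}^G) = \mathrm{psum}(\vec{d}^H)$.
   Context: All graphs are finite, simple and undirected. $\mathrm{Hom}(G,H)$ is the set of homomorphisms from $G$ to $H$. A tree is a connected acyclic graph. $\gamma(G)$ denotes the number of connected components of $G$. The size parameter of a connected bipartite graph with at least two vertices is the pair $(m,n)$ of positive integers with $m\le n$ such that the two parts of its bipartition have $m$ and $n$ vertices. For a bipartite graph $G$ with $k=\gamma(G)$ components, let $(m^G_1,n^G_1),\dots,(m^G_k,n^G_k)$ be the size parameters of its components (in some fixed order), let $d^G_i = n^G_i - m^G_i$, and $\vec d^G = (d^G_1,\dots,d^G_k)$. For a tuple $\vec d=(d_1,\dots,d_k)$ of non-negative integers, $\mathrm{psum}(\vec d)$ is the multiset $\{\!\{\sum_{i\in S} d_i : S\subseteq\{1,\dots,k\}\}\!\}$. -}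

module Defs where

open import Data.Bool using (Bool; true; false; _∧_; _∨_; not; if_then_else_)
open import Data.Nat using (ℕ; zero; suc; _+_; _∸_; _⊓_; _⊔_; _≤_)
open import Data.Fin using (Fin; zero; suc; inject₁; fromℕ; _≟_)
open import Data.List using (List; []; _∷_; _++_; map; concatMap; allFin; tabulate; length; filterᵇ)
open import Data.Bool.ListAction using (and)
open import Data.Nat.ListAction using (sum)
open import Data.Product using (Σ; ∃; _×_; _,_)
open import Relation.Binary.PropositionalEquality using (_≡_; _≢_)
open import Relation.Nullary.Decidable using (⌊_⌋)
open import Function using (_⇔_; _∘_)

record Graph (n : ℕ) : Set where
  field
    adj    : Fin n → Fin n → Bool
    sym    : ∀ u v → adj u v ≡ adj v u
    irrefl : ∀ v → adj v v ≡ false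
open Graph public

Adj : ∀ {n} → Graph n → Fin n → Fin n → Set
Adj G u v = adj G u v ≡ true

-- all functions Fin n → Fin m (each exactly once, as lookup tables)
allFuns : (n m : ℕ) → List (Fin n → Fin m)
allFuns zero    m = (λ ()) ∷ []
allFuns (suc n) m =
  concatMap (λ x → map (λ f → λ { zero → x ; (suc i) → f i }) (allFuns n m)) (allFin m)

isHomᵇ : ∀ {n m} → Graph n → Graph m → (Fin n → Fin m) → Bool
isHomᵇ {n} G H f =
  and (concatMap (λ u → map (λ v → not (adj G u v) ∨ adj H (f u) (f v)) (allFin n)) (allFin n))

homCount : ∀ {n m} → Graph n → Graph m → ℕ
homCount {n} {m} G H = length (filterᵇ (isHomᵇ G H) (allFuns n m))

data Walk {n} (G : Graph n) : Fin n → Fin n → ℕ → Set where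
  [] : ∀ {u} → Walk G u u zero
  _∷_ : ∀ {u w v ℓ} → Adj G u w → Walk G w v ℓ → Walk G u v (suc ℓ)

Reachable : ∀ {n} → Graph n → Fin n → Fin n → Set
Reachable G u v = ∃ λ ℓ → Walk G u v ℓ

Connected : ∀ {n} → Graph n → Set
Connected G = ∀ u v → Reachable G u v

record Cycle {n} (G : Graph n) : Set where
  field
    len    : ℕ
    vert   : Fin (suc (suc (suc len))) → Fin n
    inj    : ∀ i j → vert i ≡ vert j → i ≡ j
    step   : ∀ (i : Fin (suc (suc len))) → Adj G (vert (inject₁ i)) (vert (suc i))
    close  : Adj G (vert (fromℕ (suc (suc len)))) (vert zero)

Acyclic : ∀ {n} → Graph n → Set
Acyclic G = Cycle G → Data.Empty.⊥
  where import Data.Empty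

IsTree : ∀ {n} → Graph n → Set
IsTree G = Connected G × Acyclic G

DiameterAtMost : ∀ {n} → ℕ → Graph n → Set
DiameterAtMost k G = ∀ u v → ∃ λ ℓ → ℓ ≤ k × Walk G u v ℓ

ProperColouring : ∀ {n} → Graph n → (Fin n → Bool) → Set
ProperColouring G col = ∀ u v → Adj G u v → col u ≢ col v

Bipartite : ∀ {n} → Graph n → Set
Bipartite G = Σ _ (ProperColouring G)

ComponentsAtLeastTwo : ∀ {n} → Graph n → Set
ComponentsAtLeastTwo G = ∀ v → ∃ λ u → (u ≢ v) × Reachable G v u

record Components {n} (G : Graph n) : Set where
  field
    k       : ℕ
    comp    : Fin n → Fin k
    surj    : ∀ i → ∃ λ v → comp v ≡ i
    correct : ∀ u v → (comp u ≡ comp v) ⇔ Reachable G u v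
open Components public

γ : ∀ {n} {G : Graph n} → Components G → ℕ
γ C = k C

countᵇ : ∀ {n} → (Fin n → Bool) → ℕ
countᵇ {n} p = length (filterᵇ p (allFin n))

module _ {n} {G : Graph n} (B : Bipartite G) (C : Components G) where
  private
    col = Data.Product.proj₁ B
      where import Data.Product
    partTrue partFalse : Fin (k C) → ℕ
    partTrue  i = countᵇ (λ v → ⌊ comp C v ≟ i ⌋ ∧ col v)
    partFalse i = countᵇ (λ v → ⌊ comp C v ≟ i ⌋ ∧ not (col v))

  mPar nPar dPar : Fin (k C) → ℕ
  mPar i = partTrue i ⊓ partFalse i
  nPar i = partTrue i ⊔ partFalse i
  dPar i = nPar i ∸ mPar i

  sumM : ℕ
  sumM = sum (tabulate mPar)

  dVec : List ℕ
  dVec = tabulate dPar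

-- psum(d⃗): the multiset (list up to permutation) of the sums Σ_{i∈S} d_i,
-- one entry for each subset S ⊆ {1,…,k}  (2^k entries)
psum : List ℕ → List ℕ
psum []       = 0 ∷ []
psum (d ∷ ds) = psum ds ++ map (d +_) (psum ds)

{-# OPTIONS --safe #-}
-- A tree of diameter at most 2 is a star K₁,ₛ: some centre c meets every edge. A homomorphism
-- into it maps every component of G (connected, bipartite, with an edge) by sending one colour
-- class to c and the other into the s leaves. With parts mᵢ ≤ nᵢ and dᵢ = nᵢ - mᵢ this gives
--   |Hom(G, K₁,ₛ)| = ∏ᵢ (s ^ mᵢ + s ^ nᵢ) = s ^ Σ mᵢ · ∏ᵢ (1 + s ^ dᵢ) = Σ_{e ∈ E} s ^ e,
-- E being the multiset {Σ mᵢ + Σ_{i ∈ S} dᵢ : S ⊆ {1, …, γ}}, so the counts depend only on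
-- Σ mᵢ and psum(d⃗). Conversely s ↦ Σ_{e ∈ E} s ^ e determines E: its value at 1 is |E|, and
-- at s = |E| + 1 the multiplicities of the exponents are the base-s digits. From E one reads
-- off γ (as |E| = 2 ^ γ), Σ mᵢ (the least element) and then psum(d⃗).
module Submission where

open import Defs hiding (sym)
open import Data.Bool.Base using (Bool; true; false; not; _∧_; _∨_; _xor_)
open import Data.Bool.Properties
  using (T-≡; ¬-not; not-injective; xor-comm; xor-same; xor-assoc; xor-identityʳ; xor-annihilates-not)
  renaming (_≟_ to _≟ᵇ_)
open import Data.Bool.ListAction using (and)
open import Data.Nat.Base using (ℕ; zero; suc; _+_; _*_; _^_; _⊓_; _⊔_; _∸_; _≤_; _<_; z≤n; s≤s; NonZero)
open import Data.Nat.Properties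
  using ( +-comm; *-comm; +-identityʳ; *-identityʳ; *-zeroʳ; *-distribˡ-+; ^-distribˡ-+-*; ^-zeroˡ
        ; +-cancelˡ-≡; *-cancelˡ-≡; ≤-refl; ≤-reflexive; ≤-antisym; ≤-total; ≤-<-trans; m≤m+n; m≤n⇒m≤1+n
        ; m≤n⇒m⊓n≡m; m≤n⇒m⊔n≡n; m≥n⇒m⊓n≡n; m≥n⇒m⊔n≡m; m⊓n≤m⊔n; m+[n∸m]≡n; m+n∸m≡n
        ; +-*-semiring; *-1-commutativeMonoid; +-commutativeSemigroup)
open import Data.Nat.DivMod using (_%_; [m+kn]%n≡m%n; m<n⇒m%n≡m)
open import Data.Nat.Logarithm using (⌊log₂_⌋; ⌊log₂[2^n]⌋≡n)
open import Data.Nat.ListAction using (sum)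
open import Data.Nat.ListAction.Properties using (sum-++; sum-↭)
open import Algebra.Properties.CommutativeSemigroup +-commutativeSemigroup using (x∙yz≈y∙xz)
open import Algebra.Properties.Semiring.Sum +-*-semiring
  using (sum-syntax; sum-cong-≗; sum-replicate-zero; ∑-comm; *-distribʳ-sum)
open import Algebra.Properties.CommutativeMonoid.Sum *-1-commutativeMonoid
  using () renaming (sum to ∏; sum-cong-≗ to ∏-cong; ∑-distrib-+ to ∏-distrib-*)
open import Data.Fin.Base using (Fin; zero; suc; inject₁; fromℕ)
open import Data.Fin.Patterns using (0F; 1F; 2F; 3F)
open import Data.Fin.Properties using (_≟_; all?; any?; suc-injective; 2↔Bool)
open import Data.List.Base
  using (List; []; _∷_; _++_; map; concatMap; allFin; tabulate; length; filterᵇ; lookup; replicate)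
open import Data.List.Properties
  using (map-++; map-∘; map-cong; map-id; map-tabulate; length-map; length-++; length-tabulate)
open import Data.List.Extrema.Nat using (max; xs≤max)
open import Data.List.Membership.Propositional using (_∈_)
open import Data.List.Membership.Propositional.Properties using (∈-map⁻; ∈-map⁺; ∈-++⁺ˡ)
open import Data.List.Relation.Unary.All as All using (All; []; _∷_)
import Data.List.Relation.Unary.All.Properties as Allₚ
open import Data.List.Relation.Unary.Any using (here)
open import Data.List.Relation.Binary.Permutation.Propositional
  using (_↭_; ↭-refl; ↭-sym; ↭-trans; prep; module PermutationReasoning)
open import Data.List.Relation.Binary.Permutation.Propositional.Properties
  using (map⁺; ++⁺ˡ; shift; ∈-resp-↭; ↭-length)
open import Data.Vec.Base as Vec using (Vec; []; _∷_)
open import Data.Vec.Relation.Unary.All using ([]; _∷_)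
open import Data.Vec.Relation.Unary.AllPairs using ([]; _∷_)
open import Data.Vec.Relation.Unary.Unique.Propositional using (Unique)
open import Data.Vec.Relation.Unary.Unique.Propositional.Properties using (lookup-injective)
open import Data.Product using (_×_; _,_; ∃; proj₁; proj₂)
open import Data.Sum using (_⊎_; inj₁; inj₂)
open import Data.Empty using (⊥; ⊥-elim)
open import Relation.Nullary using (¬_; ¬?; Dec; yes; no; _×-dec_)
open import Relation.Nullary.Decidable
  using (⌊_⌋; isYes≗does; dec-true; dec-false; toWitness; decidable-stable)
open import Relation.Binary.PropositionalEquality
open import Function using (_∘_; _⇔_; mk⇔; Equivalence; Inverse; case_of_)

𝟙 : Bool → ℕ
𝟙 true  = 1
𝟙 false = 0

module _ {A : Set} where

  ⌊⌋-yes : (a? : Dec A) → A → ⌊ a? ⌋ ≡ true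
  ⌊⌋-yes a? a = trans (isYes≗does a?) (dec-true a? a)

  ⌊⌋-no : (a? : Dec A) → ¬ A → ⌊ a? ⌋ ≡ false
  ⌊⌋-no a? ¬a = trans (isYes≗does a?) (dec-false a? ¬a)

  ⌊⌋-true⇒ : (a? : Dec A) → ⌊ a? ⌋ ≡ true → A
  ⌊⌋-true⇒ a? e = toWitness {a? = a?} (Equivalence.from T-≡ e)

and-true⁺ : ∀ {bs} → All (_≡ true) bs → and bs ≡ true
and-true⁺ []          = refl
and-true⁺ (refl ∷ bs) = and-true⁺ bs

and-true⁻ : ∀ bs → and bs ≡ true → All (_≡ true) bs
and-true⁻ []          _ = []
and-true⁻ (true ∷ bs) e = refl ∷ and-true⁻ bs e

xor-cancelˡ : ∀ b {x y} → b xor x ≡ b xor y → x ≡ y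
xor-cancelˡ false e = e
xor-cancelˡ true  e = not-injective e

xor-solveʳ : ∀ {x y z} → x xor y ≡ z → x ≡ z xor y
xor-solveʳ {x} {y} refl =
  sym (trans (xor-assoc x y y) (trans (cong (x xor_) (xor-same y)) (xor-identityʳ x)))

-- Finite sums and products

module _ {A : Set} where

  length-filterᵇ : (p : A → Bool) (xs : List A) → length (filterᵇ p xs) ≡ sum (map (𝟙 ∘ p) xs)
  length-filterᵇ p []       = refl
  length-filterᵇ p (x ∷ xs) with p x
  ... | true  = cong suc (length-filterᵇ p xs)
  ... | false = length-filterᵇ p xs

  sum-map-≡0 : {g : A → ℕ} → (∀ x → g x ≡ 0) → ∀ xs → sum (map g xs) ≡ 0
  sum-map-≡0 g≡0 []       = refl
  sum-map-≡0 g≡0 (x ∷ xs) = cong₂ _+_ (g≡0 x) (sum-map-≡0 g≡0 xs)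

  sum-map-*ˡ : ∀ a (g : A → ℕ) xs → sum (map (λ x → a * g x) xs) ≡ a * sum (map g xs)
  sum-map-*ˡ a g []       = sym (*-zeroʳ a)
  sum-map-*ˡ a g (x ∷ xs) = trans (cong (a * g x +_) (sum-map-*ˡ a g xs)) (sym (*-distribˡ-+ a (g x) _))

  sum-map-concatMap : {B : Set} (g : B → ℕ) (f : A → List B) (xs : List A) →
                      sum (map g (concatMap f xs)) ≡ sum (map (λ x → sum (map g (f x))) xs)
  sum-map-concatMap g f []       = refl
  sum-map-concatMap g f (x ∷ xs) = begin
    sum (map g (f x ++ concatMap f xs))                 ≡⟨ cong sum (map-++ g (f x) _) ⟩
    sum (map g (f x) ++ map g (concatMap f xs))         ≡⟨ sum-++ (map g (f x)) _ ⟩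
    sum (map g (f x)) + sum (map g (concatMap f xs))    ≡⟨ cong (_ +_) (sum-map-concatMap g f xs) ⟩
    sum (map g (f x)) + sum (map (λ x → sum (map g (f x))) xs) ∎
    where open ≡-Reasoning

  sum-map-lookup : (g : A → ℕ) (xs : List A) → sum (map g xs) ≡ ∑[ i < length xs ] g (lookup xs i)
  sum-map-lookup g []       = refl
  sum-map-lookup g (x ∷ xs) = cong (g x +_) (sum-map-lookup g xs)

sum-map-comm : {A B : Set} (g : A → B → ℕ) (xs : List A) (ys : List B) →
               sum (map (λ x → sum (map (g x) ys)) xs) ≡ sum (map (λ y → sum (map (λ x → g x y) xs)) ys)
sum-map-comm g xs ys = begin
  sum (map (λ x → sum (map (g x) ys)) xs)
    ≡⟨ sum-map-lookup (λ x → sum (map (g x) ys)) xs ⟩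
  ∑[ i < length xs ] sum (map (g (lookup xs i)) ys)
    ≡⟨ sum-cong-≗ (λ i → sum-map-lookup (g (lookup xs i)) ys) ⟩
  ∑[ i < length xs ] ∑[ j < length ys ] g (lookup xs i) (lookup ys j)
    ≡⟨ ∑-comm (λ i j → g (lookup xs i) (lookup ys j)) ⟩
  ∑[ j < length ys ] ∑[ i < length xs ] g (lookup xs i) (lookup ys j)
    ≡⟨ sum-cong-≗ (λ j → sum-map-lookup (λ x → g x (lookup ys j)) xs) ⟨
  ∑[ j < length ys ] sum (map (λ x → g x (lookup ys j)) xs)
    ≡⟨ sum-map-lookup (λ y → sum (map (λ x → g x y) xs)) ys ⟨
  sum (map (λ y → sum (map (λ x → g x y) xs)) ys) ∎
  where open ≡-Reasoning

sum-tabulate : ∀ {n} (f : Fin n → ℕ) → sum (tabulate f) ≡ ∑[ i < n ] f i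
sum-tabulate {zero}  f = refl
sum-tabulate {suc n} f = cong (f zero +_) (sum-tabulate (f ∘ suc))

sum-map-allFin : ∀ {n} (f : Fin n → ℕ) → sum (map f (allFin n)) ≡ ∑[ i < n ] f i
sum-map-allFin f = trans (cong sum (map-tabulate (λ i → i) f)) (sum-tabulate f)

countᵇ-∑ : ∀ {n} (p : Fin n → Bool) → countᵇ p ≡ ∑[ i < n ] 𝟙 (p i)
countᵇ-∑ {n} p = trans (length-filterᵇ p (allFin n)) (sum-map-allFin (𝟙 ∘ p))

∑-δ : ∀ {n} (f : Fin n → ℕ) j → (∀ i → i ≢ j → f i ≡ 0) → ∑[ i < n ] f i ≡ f j
∑-δ {suc n} f zero    vanish = trans (cong (f zero +_) rest≡0) (+-identityʳ _)
  where rest≡0 = trans (sum-cong-≗ (λ i → vanish (suc i) λ ())) (sum-replicate-zero n)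
∑-δ {suc n} f (suc j) vanish =
  cong₂ _+_ (vanish zero λ ()) (∑-δ (f ∘ suc) j (λ i i≢j → vanish (suc i) (i≢j ∘ suc-injective)))

∑-𝟙-≟ : ∀ {n} (j : Fin n) → ∑[ i < n ] 𝟙 ⌊ i ≟ j ⌋ ≡ 1
∑-𝟙-≟ j = trans (∑-δ _ j (λ i i≢j → cong 𝟙 (⌊⌋-no (i ≟ j) i≢j))) (cong 𝟙 (⌊⌋-yes (j ≟ j) refl))

∑-𝟙-select : ∀ {n} (j : Fin n) (p : Fin n → Bool) → ∑[ i < n ] 𝟙 (⌊ j ≟ i ⌋ ∧ p i) ≡ 𝟙 (p j)
∑-𝟙-select j p = trans (∑-δ _ j (λ i i≢j → cong (λ b → 𝟙 (b ∧ p i)) (⌊⌋-no (j ≟ i) (i≢j ∘ sym))))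
                       (cong (λ b → 𝟙 (b ∧ p j)) (⌊⌋-yes (j ≟ j) refl))

∏-pow : ∀ {n} s (e : Fin n → ℕ) → (∏ λ i → s ^ e i) ≡ s ^ ∑[ i < n ] e i
∏-pow {zero}  s e = refl
∏-pow {suc n} s e = trans (cong (s ^ e zero *_) (∏-pow s (e ∘ suc))) (sym (^-distribˡ-+-* s (e zero) _))

∏-𝟙-all : ∀ {n} (b : Fin n → Bool) → (∀ i → b i ≡ true) → ∏ (𝟙 ∘ b) ≡ 1
∏-𝟙-all {zero}  b all = refl
∏-𝟙-all {suc n} b all rewrite all zero = trans (+-identityʳ _) (∏-𝟙-all (b ∘ suc) (all ∘ suc))

∏-𝟙-¬all : ∀ {n} (b : Fin n → Bool) → ¬ (∀ i → b i ≡ true) → ∏ (𝟙 ∘ b) ≡ 0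
∏-𝟙-¬all {zero}  b ¬all = ⊥-elim (¬all λ ())
∏-𝟙-¬all {suc n} b ¬all with b zero in b₀
... | false = refl
... | true  = trans (+-identityʳ _) (∏-𝟙-¬all (b ∘ suc) λ all → ¬all λ { zero → b₀ ; (suc i) → all i })

∏-𝟙-cong : ∀ {m n} (b : Fin m → Bool) (b′ : Fin n → Bool) →
           (∀ i → b i ≡ true) ⇔ (∀ j → b′ j ≡ true) → ∏ (𝟙 ∘ b) ≡ ∏ (𝟙 ∘ b′)
∏-𝟙-cong b b′ b⇔b′ with all? (λ i → b i ≟ᵇ true)
... | yes all = trans (∏-𝟙-all b all) (sym (∏-𝟙-all b′ (Equivalence.to b⇔b′ all)))
... | no ¬all = trans (∏-𝟙-¬all b ¬all) (sym (∏-𝟙-¬all b′ (¬all ∘ Equivalence.from b⇔b′)))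

sum-allFuns-∏ : ∀ n m (h : Fin n → Fin m → ℕ) →
                sum (map (λ f → ∏ λ i → h i (f i)) (allFuns n m)) ≡ ∏ λ i → ∑[ x < m ] h i x
sum-allFuns-∏ zero    m h = refl
sum-allFuns-∏ (suc n) m h = begin
  sum (map (λ f → ∏ λ i → h i (f i)) (allFuns (suc n) m))
    ≡⟨ sum-map-concatMap _ _ (allFin m) ⟩
  -- the `_` is the pattern lambda of allFuns that puts x in front
  sum (map (λ x → sum (map (λ f → ∏ λ i → h i (f i)) (map _ (allFuns n m)))) (allFin m))
    ≡⟨ cong sum (map-cong (λ x → cong sum (sym (map-∘ (allFuns n m)))) (allFin m)) ⟩
  sum (map (λ x → sum (map (λ f → h zero x * ∏ λ i → h (suc i) (f i)) (allFuns n m))) (allFin m))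
    ≡⟨ cong sum (map-cong (λ x → sum-map-*ˡ (h zero x) _ (allFuns n m)) (allFin m)) ⟩
  sum (map (λ x → h zero x * rest) (allFin m))
    ≡⟨ sum-map-allFin (λ x → h zero x * rest) ⟩
  ∑[ x < m ] (h zero x * rest)
    ≡⟨ *-distribʳ-sum rest (h zero) ⟨
  (∑[ x < m ] h zero x) * rest
    ≡⟨ cong ((∑[ x < m ] h zero x) *_) (sum-allFuns-∏ n m (h ∘ suc)) ⟩
  (∑[ x < m ] h zero x) * (∏ λ i → ∑[ x < m ] h (suc i) x) ∎
  where
  open ≡-Reasoning
  rest = sum (map (λ f → ∏ λ i → h (suc i) (f i)) (allFuns n m))

-- Power sums and subset sums

powerSum : ℕ → List ℕ → ℕ
powerSum s = sum ∘ map (s ^_)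

powerSum-++ : ∀ s xs ys → powerSum s (xs ++ ys) ≡ powerSum s xs + powerSum s ys
powerSum-++ s xs ys = trans (cong sum (map-++ (s ^_) xs ys)) (sum-++ (map (s ^_) xs) _)

powerSum-shift : ∀ s d xs → powerSum s (map (d +_) xs) ≡ s ^ d * powerSum s xs
powerSum-shift s d xs = begin
  sum (map (s ^_) (map (d +_) xs))      ≡⟨ cong sum (map-∘ xs) ⟨
  sum (map (λ x → s ^ (d + x)) xs)      ≡⟨ cong sum (map-cong (^-distribˡ-+-* s d) xs) ⟩
  sum (map (λ x → s ^ d * s ^ x) xs)    ≡⟨ sum-map-*ˡ (s ^ d) (s ^_) xs ⟩
  s ^ d * powerSum s xs                 ∎
  where open ≡-Reasoning

powerSum-one : ∀ xs → powerSum 1 xs ≡ length xs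
powerSum-one []       = refl
powerSum-one (x ∷ xs) = cong₂ _+_ (^-zeroˡ x) (powerSum-one xs)

powerSum-↭ : ∀ s {E E′} → E ↭ E′ → powerSum s E ≡ powerSum s E′
powerSum-↭ s E↭E′ = sum-↭ (map⁺ (s ^_) E↭E′)

powerSum-psum : ∀ {k} s (d : Fin k → ℕ) → powerSum s (psum (tabulate d)) ≡ ∏ λ i → 1 + s ^ d i
powerSum-psum {zero}  s d = refl
powerSum-psum {suc k} s d = begin
  powerSum s (P ++ map (d zero +_) P)      ≡⟨ powerSum-++ s P _ ⟩
  powerSum s P + powerSum s (map (d zero +_) P) ≡⟨ cong (powerSum s P +_) (powerSum-shift s (d zero) P) ⟩
  (1 + s ^ d zero) * powerSum s P          ≡⟨ cong ((1 + s ^ d zero) *_) (powerSum-psum s (d ∘ suc)) ⟩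
  (1 + s ^ d zero) * (∏ λ i → 1 + s ^ d (suc i)) ∎
  where
  open ≡-Reasoning
  P = psum (tabulate (d ∘ suc))

^-+-⊓⊔ : ∀ s a b → s ^ a + s ^ b ≡ s ^ (a ⊓ b) + s ^ (a ⊔ b)
^-+-⊓⊔ s a b with ≤-total a b
... | inj₁ a≤b rewrite m≤n⇒m⊓n≡m a≤b | m≤n⇒m⊔n≡n a≤b = refl
... | inj₂ b≤a rewrite m≥n⇒m⊓n≡n b≤a | m≥n⇒m⊔n≡m b≤a = +-comm (s ^ a) (s ^ b)

^-+-factor : ∀ s a b → s ^ a + s ^ b ≡ s ^ (a ⊓ b) * (1 + s ^ (a ⊔ b ∸ a ⊓ b))
^-+-factor s a b = begin
  s ^ a + s ^ b                           ≡⟨ ^-+-⊓⊔ s a b ⟩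
  s ^ (a ⊓ b) + s ^ (a ⊔ b)               ≡⟨ cong (λ e → s ^ (a ⊓ b) + s ^ e) (m+[n∸m]≡n (m⊓n≤m⊔n a b)) ⟨
  s ^ (a ⊓ b) + s ^ (a ⊓ b + d)           ≡⟨ cong (s ^ (a ⊓ b) +_) (^-distribˡ-+-* s (a ⊓ b) d) ⟩
  s ^ (a ⊓ b) + s ^ (a ⊓ b) * s ^ d       ≡⟨ cong (_+ s ^ (a ⊓ b) * s ^ d) (*-identityʳ (s ^ (a ⊓ b))) ⟨
  s ^ (a ⊓ b) * 1 + s ^ (a ⊓ b) * s ^ d   ≡⟨ *-distribˡ-+ (s ^ (a ⊓ b)) 1 (s ^ d) ⟨
  s ^ (a ⊓ b) * (1 + s ^ d)               ∎
  where
  open ≡-Reasoning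
  d = a ⊔ b ∸ a ⊓ b

∏-^-+ : ∀ {k} s (a b : Fin k → ℕ) →
        (∏ λ i → s ^ a i + s ^ b i) ≡
        s ^ sum (tabulate λ i → a i ⊓ b i) * powerSum s (psum (tabulate λ i → a i ⊔ b i ∸ a i ⊓ b i))
∏-^-+ {k} s a b = begin
  (∏ λ i → s ^ a i + s ^ b i)
    ≡⟨ ∏-cong (λ i → ^-+-factor s (a i) (b i)) ⟩
  (∏ λ i → s ^ (a i ⊓ b i) * (1 + s ^ d i))
    ≡⟨ ∏-distrib-* (λ i → s ^ (a i ⊓ b i)) (λ i → 1 + s ^ d i) ⟩
  (∏ λ i → s ^ (a i ⊓ b i)) * (∏ λ i → 1 + s ^ d i)
    ≡⟨ cong₂ _*_ (∏-pow s (λ i → a i ⊓ b i)) (sym (powerSum-psum s d)) ⟩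
  s ^ (∑[ i < k ] (a i ⊓ b i)) * powerSum s (psum (tabulate d))
    ≡⟨ cong (λ M → s ^ M * powerSum s (psum (tabulate d))) (sum-tabulate (λ i → a i ⊓ b i)) ⟨
  s ^ sum (tabulate λ i → a i ⊓ b i) * powerSum s (psum (tabulate d)) ∎
  where
  open ≡-Reasoning
  d : Fin k → ℕ
  d i = a i ⊔ b i ∸ a i ⊓ b i

zeroCount : List ℕ → ℕ
zeroCount []           = 0
zeroCount (zero  ∷ xs) = suc (zeroCount xs)
zeroCount (suc _ ∷ xs) = zeroCount xs

lowered : List ℕ → List ℕ
lowered []           = []
lowered (zero  ∷ xs) = lowered xs
lowered (suc x ∷ xs) = x ∷ lowered xs

↭-zeros-lowered : ∀ xs → xs ↭ replicate (zeroCount xs) 0 ++ map suc (lowered xs)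
↭-zeros-lowered []           = ↭-refl
↭-zeros-lowered (zero  ∷ xs) = prep 0 (↭-zeros-lowered xs)
↭-zeros-lowered (suc x ∷ xs) =
  ↭-trans (prep (suc x) (↭-zeros-lowered xs)) (↭-sym (shift (suc x) (replicate (zeroCount xs) 0) _))

powerSum-digits : ∀ B xs → powerSum B xs ≡ zeroCount xs + B * powerSum B (lowered xs)
powerSum-digits B []           = sym (*-zeroʳ B)
powerSum-digits B (zero  ∷ xs) = cong suc (powerSum-digits B xs)
powerSum-digits B (suc x ∷ xs) = begin
  B * B ^ x + powerSum B xs                         ≡⟨ cong (B * B ^ x +_) (powerSum-digits B xs) ⟩
  B * B ^ x + (zeroCount xs + B * powerSum B ys)    ≡⟨ x∙yz≈y∙xz (B * B ^ x) (zeroCount xs) _ ⟩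
  zeroCount xs + (B * B ^ x + B * powerSum B ys)    ≡⟨ cong (zeroCount xs +_) (*-distribˡ-+ B (B ^ x) _) ⟨
  zeroCount xs + B * (B ^ x + powerSum B ys)        ∎
  where
  open ≡-Reasoning
  ys = lowered xs

zeroCount≤length : ∀ xs → zeroCount xs ≤ length xs
zeroCount≤length []           = z≤n
zeroCount≤length (zero  ∷ xs) = s≤s (zeroCount≤length xs)
zeroCount≤length (suc _ ∷ xs) = m≤n⇒m≤1+n (zeroCount≤length xs)

length-lowered≤ : ∀ xs → length (lowered xs) ≤ length xs
length-lowered≤ []           = z≤n
length-lowered≤ (zero  ∷ xs) = m≤n⇒m≤1+n (length-lowered≤ xs)
length-lowered≤ (suc _ ∷ xs) = s≤s (length-lowered≤ xs)

lowered-< : ∀ {N} xs → All (_< suc N) xs → All (_< N) (lowered xs)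
lowered-< []           []                = []
lowered-< (zero  ∷ xs) (_ ∷ xs<)         = lowered-< xs xs<
lowered-< (suc x ∷ xs) (s≤s x<N ∷ xs<)   = x<N ∷ lowered-< xs xs<

base-digits-unique : ∀ {B} .{{_ : NonZero B}} {z z′ x y} → z < B → z′ < B →
                     z + B * x ≡ z′ + B * y → z ≡ z′ × x ≡ y
base-digits-unique {B} {z} {z′} {x} {y} z<B z′<B eq =
  z≡z′ , *-cancelˡ-≡ x y B (+-cancelˡ-≡ z′ _ _ (trans (cong (_+ B * x) (sym z≡z′)) eq))
  where
  lowDigit : ∀ {z} x → z < B → (z + B * x) % B ≡ z
  lowDigit {z} x z<B =
    trans (cong (λ t → (z + t) % B) (*-comm B x)) (trans ([m+kn]%n≡m%n z x B) (m<n⇒m%n≡m z<B))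
  z≡z′ = trans (sym (lowDigit x z<B)) (trans (cong (_% B) eq) (lowDigit y z′<B))

-- The number of zero exponents is the last base-B digit; the lowered positive exponents give the rest.
powerSum-base-injective : ∀ N {B} .{{_ : NonZero B}} {E E′} → All (_< N) E → All (_< N) E′ →
                          length E < B → length E′ < B → powerSum B E ≡ powerSum B E′ → E ↭ E′
powerSum-base-injective zero    [] [] _ _ _ = ↭-refl
powerSum-base-injective (suc N) {B} {E} {E′} E<N E′<N |E|<B |E′|<B eq = begin
  E
    ↭⟨ ↭-zeros-lowered E ⟩
  replicate (zeroCount E) 0 ++ map suc (lowered E)
    ≡⟨ cong (λ z → replicate z 0 ++ map suc (lowered E)) (proj₁ digits) ⟩
  replicate (zeroCount E′) 0 ++ map suc (lowered E)
    ↭⟨ ++⁺ˡ (replicate (zeroCount E′) 0) (map⁺ suc lowered↭) ⟩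
  replicate (zeroCount E′) 0 ++ map suc (lowered E′)
    ↭⟨ ↭-zeros-lowered E′ ⟨
  E′ ∎
  where
  open PermutationReasoning
  digits = base-digits-unique (≤-<-trans (zeroCount≤length E) |E|<B)
                              (≤-<-trans (zeroCount≤length E′) |E′|<B)
                              (trans (sym (powerSum-digits B E)) (trans eq (powerSum-digits B E′)))
  lowered↭ = powerSum-base-injective N (lowered-< E E<N) (lowered-< E′ E′<N)
               (≤-<-trans (length-lowered≤ E) |E|<B) (≤-<-trans (length-lowered≤ E′) |E′|<B) (proj₂ digits)

powerSum-injective : ∀ {E E′} → (∀ s → powerSum s E ≡ powerSum s E′) → E ↭ E′
powerSum-injective {E} {E′} eq =
  powerSum-base-injective (suc (max 0 (E ++ E′))) (Allₚ.++⁻ˡ E bounds) (Allₚ.++⁻ʳ E bounds)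
    ≤-refl (s≤s (≤-reflexive (sym |E|≡|E′|))) (eq (suc (length E)))
  where
  |E|≡|E′| = trans (sym (powerSum-one E)) (trans (eq 1) (powerSum-one E′))
  bounds = All.map s≤s (xs≤max 0 (E ++ E′))

exponents : ℕ → List ℕ → List ℕ
exponents M ds = map (M +_) (psum ds)

exponents-cong : ∀ {M M′} ds ds′ → M ≡ M′ → psum ds ↭ psum ds′ → exponents M ds ↭ exponents M′ ds′
exponents-cong {M} _ _ refl P↭P′ = map⁺ (M +_) P↭P′

length-psum : ∀ ds → length (psum ds) ≡ 2 ^ length ds
length-psum []       = refl
length-psum (d ∷ ds) = begin
  length (psum ds ++ map (d +_) (psum ds))          ≡⟨ length-++ (psum ds) ⟩
  length (psum ds) + length (map (d +_) (psum ds))  ≡⟨ cong (length (psum ds) +_) (length-map (d +_) (psum ds)) ⟩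
  length (psum ds) + length (psum ds)               ≡⟨ cong (λ l → l + l) (length-psum ds) ⟩
  2 ^ length ds + 2 ^ length ds                     ≡⟨ cong (2 ^ length ds +_) (+-identityʳ _) ⟨
  2 ^ suc (length ds)                               ∎
  where open ≡-Reasoning

0∈psum : ∀ ds → 0 ∈ psum ds
0∈psum []       = here refl
0∈psum (d ∷ ds) = ∈-++⁺ˡ (0∈psum ds)

2^-injective : ∀ {m n} → 2 ^ m ≡ 2 ^ n → m ≡ n
2^-injective {m} {n} eq = trans (sym (⌊log₂[2^n]⌋≡n m)) (trans (cong ⌊log₂_⌋ eq) (⌊log₂[2^n]⌋≡n n))

exponents-injective : ∀ {M M′} ds ds′ → exponents M ds ↭ exponents M′ ds′ →
                      length ds ≡ length ds′ × M ≡ M′ × psum ds ↭ psum ds′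
exponents-injective {M} {M′} ds ds′ E↭E′ = |ds|≡|ds′| , M≡M′ , psum↭
  where
  |ds|≡|ds′| = 2^-injective (begin
    2 ^ length ds                 ≡⟨ length-psum ds ⟨
    length (psum ds)              ≡⟨ length-map (M +_) (psum ds) ⟨
    length (exponents M ds)       ≡⟨ ↭-length E↭E′ ⟩
    length (exponents M′ ds′)     ≡⟨ length-map (M′ +_) (psum ds′) ⟩
    length (psum ds′)             ≡⟨ length-psum ds′ ⟩
    2 ^ length ds′                ∎)
    where open ≡-Reasoning
  offset≤ : ∀ {K x} P → x ∈ map (K +_) P → K ≤ x
  offset≤ {K} P x∈ with ∈-map⁻ (K +_) x∈
  ... | y , _ , refl = m≤m+n K y
  offset∈ : ∀ K ds → K ∈ exponents K ds
  offset∈ K ds = subst (_∈ exponents K ds) (+-identityʳ K) (∈-map⁺ (K +_) (0∈psum ds))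
  M≡M′ = ≤-antisym (offset≤ (psum ds) (∈-resp-↭ (↭-sym E↭E′) (offset∈ M′ ds′)))
                   (offset≤ (psum ds′) (∈-resp-↭ E↭E′ (offset∈ M ds)))
  unshift : ∀ P → map (_∸ M) (map (M +_) P) ≡ P
  unshift P = trans (sym (map-∘ P)) (trans (map-cong (m+n∸m≡n M) P) (map-id P))
  psum↭ = subst₂ _↭_ (unshift (psum ds)) (unshift (psum ds′))
            (map⁺ (_∸ M) (subst (λ K → exponents M ds ↭ exponents K ds′) (sym M≡M′) E↭E′))

-- Stars and trees of diameter at most two

Centred : ∀ {n} → Graph n → Fin n → Set
Centred T c = ∀ u v → Adj T u v → u ≡ c ⊎ v ≡ c

-- No walk a b c d without backtracking (a ≢ c, b ≢ d): exactly the graphs whose components are stars.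
StarForest : ∀ {n} → Graph n → Set
StarForest T = ∀ {a b c d} → Adj T a b → Adj T b c → Adj T c d → a ≢ c → b ≢ d → ⊥

module _ {n} {T : Graph n} where

  Adj-sym : ∀ {u v} → Adj T u v → Adj T v u
  Adj-sym {u} {v} uv = trans (Graph.sym T v u) uv

  Adj⇒≢ : ∀ {u v} → Adj T u v → u ≢ v
  Adj⇒≢ {u} uu refl with trans (sym (irrefl T u)) uu
  ... | ()

  centred-edge : ∀ {c x y} → Centred T c → Adj T x y → ⌊ y ≟ c ⌋ ≡ not ⌊ x ≟ c ⌋
  centred-edge {x = x} {y} centred xy with centred _ _ xy
  ... | inj₁ refl = trans (⌊⌋-no (y ≟ x) (Adj⇒≢ xy ∘ sym)) (cong not (sym (⌊⌋-yes (x ≟ x) refl)))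
  ... | inj₂ refl = trans (⌊⌋-yes (y ≟ y) refl) (cong not (sym (⌊⌋-no (x ≟ y) (Adj⇒≢ xy))))

  diameter⇒connected : ∀ {k} → DiameterAtMost k T → Connected T
  diameter⇒connected diam u v = let (ℓ , _ , walk) = diam u v in ℓ , walk

  cycle : ∀ {len} (xs : Vec (Fin n) (3 + len)) → Unique xs →
          (∀ i → Adj T (Vec.lookup xs (inject₁ i)) (Vec.lookup xs (suc i))) →
          Adj T (Vec.lookup xs (fromℕ (2 + len))) (Vec.lookup xs zero) → Cycle T
  cycle xs unique steps closing = record
    { len = _ ; vert = Vec.lookup xs ; inj = lookup-injective unique ; step = steps ; close = closing }

  centred⇒starForest : ∀ {c} → Centred T c → StarForest T
  centred⇒starForest cen ab bc cd a≢c b≢d with cen _ _ ab | cen _ _ bc | cen _ _ cd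
  ... | _          | inj₁ b≡ctr | inj₁ c≡ctr = Adj⇒≢ bc (trans b≡ctr (sym c≡ctr))
  ... | _          | inj₁ b≡ctr | inj₂ d≡ctr = b≢d (trans b≡ctr (sym d≡ctr))
  ... | inj₁ a≡ctr | inj₂ c≡ctr | _          = a≢c (trans a≡ctr (sym c≡ctr))
  ... | inj₂ b≡ctr | inj₂ c≡ctr | _          = Adj⇒≢ bc (trans b≡ctr (sym c≡ctr))

  starForest⇒acyclic : StarForest T → Acyclic T
  starForest⇒acyclic noWalk record { len = zero ; inj = inj ; step = step ; close = close } =
    noWalk (step 0F) (step 1F) close (λ e → case inj 0F 2F e of λ ()) (λ e → case inj 1F 0F e of λ ())
  starForest⇒acyclic noWalk record { len = suc _ ; inj = inj ; step = step } =
    noWalk (step 0F) (step 1F) (step 2F) (λ e → case inj 0F 2F e of λ ()) (λ e → case inj 1F 3F e of λ ())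

  no-triangle : Acyclic T → ∀ {a b c} → Adj T a b → Adj T b c → Adj T c a → ⊥
  no-triangle acyclic ab bc ca = acyclic (cycle (_ ∷ _ ∷ _ ∷ [])
    ((Adj⇒≢ ab ∷ (Adj⇒≢ ca ∘ sym) ∷ []) ∷ (Adj⇒≢ bc ∷ []) ∷ [] ∷ [])
    (λ { 0F → ab ; 1F → bc }) ca)

  module _ (diam : DiameterAtMost 2 T) where

    within-two : ∀ a b → a ≡ b ⊎ Adj T a b ⊎ ∃ λ z → Adj T a z × Adj T z b
    within-two a b with diam a b
    ... | _ , _ , []              = inj₁ refl
    ... | _ , _ , ab ∷ []         = inj₂ (inj₁ ab)
    ... | _ , _ , az ∷ zb ∷ []    = inj₂ (inj₂ (_ , az , zb))
    ... | _ , s≤s (s≤s ()) , _ ∷ _ ∷ _ ∷ _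

    -- The walk a b c d and a walk of length ≤ 2 from a to d close a cycle of length 3, 4 or 5.
    acyclic⇒starForest : Acyclic T → StarForest T
    acyclic⇒starForest acyclic {a} {b} {c} {d} ab bc cd a≢c b≢d with a ≟ d
    ... | yes refl = no-triangle acyclic ab bc cd
    ... | no a≢d with within-two a d
    ...   | inj₁ a≡d = a≢d a≡d
    ...   | inj₂ (inj₁ ad) = acyclic (cycle (a ∷ b ∷ c ∷ d ∷ [])
            ((Adj⇒≢ ab ∷ a≢c ∷ a≢d ∷ []) ∷ (Adj⇒≢ bc ∷ b≢d ∷ []) ∷ (Adj⇒≢ cd ∷ []) ∷ [] ∷ [])
            (λ { 0F → ab ; 1F → bc ; 2F → cd }) (Adj-sym ad))
    ...   | inj₂ (inj₂ (z , az , zd)) with z ≟ b | z ≟ c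
    ...     | yes refl | _        = no-triangle acyclic bc cd (Adj-sym zd)
    ...     | no _     | yes refl = no-triangle acyclic ab bc (Adj-sym az)
    ...     | no z≢b   | no z≢c   = acyclic (cycle (a ∷ b ∷ c ∷ d ∷ z ∷ [])
              ((Adj⇒≢ ab ∷ a≢c ∷ a≢d ∷ Adj⇒≢ az ∷ []) ∷ (Adj⇒≢ bc ∷ b≢d ∷ (z≢b ∘ sym) ∷ [])
                ∷ (Adj⇒≢ cd ∷ (z≢c ∘ sym) ∷ []) ∷ ((Adj⇒≢ zd ∘ sym) ∷ []) ∷ [] ∷ [])
              (λ { 0F → ab ; 1F → bc ; 2F → cd ; 3F → Adj-sym zd }) (Adj-sym az))

    module _ (noWalk : StarForest T) where

      near-pendant : ∀ {u w} → (∀ {x} → Adj T u x → x ≡ w) → ∀ x → x ≢ w → x ≡ u ⊎ Adj T w x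
      near-pendant {u} only x x≢w with within-two u x
      ... | inj₁ u≡x                  = inj₁ (sym u≡x)
      ... | inj₂ (inj₁ ux)            = ⊥-elim (x≢w (only ux))
      ... | inj₂ (inj₂ (z , uz , zx)) = inj₂ (subst (λ y → Adj T y x) (only uz) zx)

      pendant⇒centred : ∀ {u w} → (∀ {x} → Adj T u x → x ≡ w) → Centred T w
      pendant⇒centred {u} {w} only a b ab with a ≟ w | b ≟ w
      ... | yes a≡w | _       = inj₁ a≡w
      ... | no _    | yes b≡w = inj₂ b≡w
      ... | no a≢w  | no b≢w  with near-pendant only a a≢w | near-pendant only b b≢w
      ...   | inj₁ refl | _         = ⊥-elim (b≢w (only ab))
      ...   | inj₂ _    | inj₁ refl = ⊥-elim (a≢w (only (Adj-sym ab)))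
      ...   | inj₂ wa   | inj₂ wb   = ⊥-elim (noWalk wa ab (Adj-sym wb) (b≢w ∘ sym) a≢w)

      other-neighbour? : ∀ u w → Dec (∃ λ x → x ≢ w × Adj T u x)
      other-neighbour? u w = any? (λ x → ¬? (x ≟ w) ×-dec (adj T u x ≟ᵇ true))

      centre-of-edge : ∀ {u w} → Adj T u w → ∃ (Centred T)
      centre-of-edge {u} {w} uw with other-neighbour? u w | other-neighbour? w u
      ... | no none | _       = w , pendant⇒centred λ {x} ux → decidable-stable (x ≟ w) λ x≢w → none (x , x≢w , ux)
      ... | _       | no none = u , pendant⇒centred λ {x} wx → decidable-stable (x ≟ u) λ x≢u → none (x , x≢u , wx)
      ... | yes (x , x≢w , ux) | yes (y , y≢u , wy) = ⊥-elim (noWalk (Adj-sym ux) uw wy x≢w (y≢u ∘ sym))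

starForest⇒centred : ∀ {t} {T : Graph (suc t)} → DiameterAtMost 2 T → StarForest T → ∃ (Centred T)
starForest⇒centred {zero}  diam noWalk = zero , λ { zero zero _ → inj₁ refl }
starForest⇒centred {suc t} diam noWalk with within-two diam 0F 1F
... | inj₂ (inj₁ e)           = centre-of-edge diam noWalk e
... | inj₂ (inj₂ (_ , e , _)) = centre-of-edge diam noWalk e

tree-diameter≤2⇒centred : ∀ {t} {T : Graph (suc t)} → IsTree T → DiameterAtMost 2 T → ∃ (Centred T)
tree-diameter≤2⇒centred (_ , acyclic) diam = starForest⇒centred diam (acyclic⇒starForest diam acyclic)

Star : ∀ s → Graph (suc s)
Star s = record
  { adj    = λ u v → ⌊ u ≟ zero ⌋ xor ⌊ v ≟ zero ⌋
  ; sym    = λ u v → xor-comm ⌊ u ≟ zero ⌋ ⌊ v ≟ zero ⌋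
  ; irrefl = λ v → xor-same ⌊ v ≟ zero ⌋
  }

star-centred : ∀ {s} → Centred (Star s) zero
star-centred zero    _       _  = inj₁ refl
star-centred (suc _) zero    _  = inj₂ refl
star-centred (suc _) (suc _) ()

star-diameter : ∀ s → DiameterAtMost 2 (Star s)
star-diameter s zero    zero    = 0 , z≤n , []
star-diameter s zero    (suc v) = 1 , s≤s z≤n , refl ∷ []
star-diameter s (suc u) zero    = 1 , s≤s z≤n , refl ∷ []
star-diameter s (suc u) (suc v) = 2 , ≤-refl , _∷_ {w = zero} refl (refl ∷ [])

star-tree : ∀ s → IsTree (Star s)
star-tree s =
  diameter⇒connected (star-diameter s) , starForest⇒acyclic (centred⇒starForest {T = Star s} star-centred)

star-degree : ∀ s → countᵇ (adj (Star s) zero) ≡ s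
star-degree s = trans (countᵇ-∑ (adj (Star s) zero)) (ones s)
  where
  ones : ∀ s → ∑[ i < s ] 1 ≡ s
  ones zero    = refl
  ones (suc s) = cong suc (ones s)

-- Homomorphisms into a centred graph

module _ {n m} (G : Graph n) (T : Graph m) where

  IsHom : (Fin n → Fin m) → Set
  IsHom f = ∀ {u v} → Adj G u v → Adj T (f u) (f v)

  isHomᵇ-sound : ∀ f → isHomᵇ G T f ≡ true → IsHom f
  isHomᵇ-sound f e {u} {v} uv = subst (λ b → not b ∨ adj T (f u) (f v) ≡ true) uv
    (Allₚ.tabulate⁻ (Allₚ.map⁻ (Allₚ.tabulate⁻ (Allₚ.map⁻ (Allₚ.concat⁻ (and-true⁻ _ e))) u)) v)

  isHomᵇ-complete : ∀ f → IsHom f → isHomᵇ G T f ≡ true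
  isHomᵇ-complete f h =
    and-true⁺ (Allₚ.concat⁺ (Allₚ.map⁺ (Allₚ.tabulate⁺ λ u → Allₚ.map⁺ (Allₚ.tabulate⁺ λ v → edge-ok u v))))
    where
    edge-ok : ∀ u v → not (adj G u v) ∨ adj T (f u) (f v) ≡ true
    edge-ok u v with adj G u v in uv
    ... | true  = h uv
    ... | false = refl

module _ {n} {G : Graph n} (bG : Bipartite G) (nontrivial : ComponentsAtLeastTwo G) (C : Components G) where

  private
    col : Fin n → Bool
    col = proj₁ bG

    K : ℕ
    K = k C

    rep : Fin K → Fin n
    rep i = proj₁ (surj C i)

    open Inverse 2↔Bool using ()
      renaming (to to bit; from to unbit; strictlyInverseˡ to bit-unbit; strictlyInverseʳ to unbit-bit)

  -- An orientation σ : Fin K → Fin 2 chooses, for each component, which of its colour classes is sent to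
  -- the leaves; the other one is sent to the centre.
  leaf : (Fin K → Fin 2) → Fin n → Bool
  leaf σ v = bit (σ (comp C v)) xor col v

  leaves : Fin K → Fin 2 → ℕ
  leaves i y = countᵇ (λ v → ⌊ comp C v ≟ i ⌋ ∧ (bit y xor col v))

  ∑-leaf : ∀ σ → ∑[ v < n ] 𝟙 (leaf σ v) ≡ ∑[ i < K ] leaves i (σ i)
  ∑-leaf σ = begin
    ∑[ v < n ] 𝟙 (leaf σ v)
      ≡⟨ sum-cong-≗ (λ v → ∑-𝟙-select (comp C v) (λ i → bit (σ i) xor col v)) ⟨
    ∑[ v < n ] ∑[ i < K ] 𝟙 (⌊ comp C v ≟ i ⌋ ∧ (bit (σ i) xor col v))
      ≡⟨ ∑-comm (λ v i → 𝟙 (⌊ comp C v ≟ i ⌋ ∧ (bit (σ i) xor col v))) ⟩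
    ∑[ i < K ] ∑[ v < n ] 𝟙 (⌊ comp C v ≟ i ⌋ ∧ (bit (σ i) xor col v))
      ≡⟨ sum-cong-≗ (λ i → countᵇ-∑ (λ v → ⌊ comp C v ≟ i ⌋ ∧ (bit (σ i) xor col v))) ⟨
    ∑[ i < K ] leaves i (σ i) ∎
    where open ≡-Reasoning

  module _ {m} {T : Graph m} {c : Fin m} (centred : Centred T c) where

    private
      s : ℕ
      s = countᵇ (adj T c)

    fitsAt : Bool → Fin m → Bool
    fitsAt true  x = adj T c x
    fitsAt false x = ⌊ x ≟ c ⌋

    fitsᵇ : (Fin K → Fin 2) → (Fin n → Fin m) → Fin n → Bool
    fitsᵇ σ f v = fitsAt (leaf σ v) (f v)

    Fits : (Fin K → Fin 2) → (Fin n → Fin m) → Set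
    Fits σ f = ∀ v → fitsᵇ σ f v ≡ true

    ∑-fitsAt : ∀ b → ∑[ x < m ] 𝟙 (fitsAt b x) ≡ s ^ 𝟙 b
    ∑-fitsAt true  = trans (sym (countᵇ-∑ (adj T c))) (sym (*-identityʳ s))
    ∑-fitsAt false = ∑-𝟙-≟ c

    fitsAt-side : ∀ b {x} → fitsAt b x ≡ true → b ≡ not ⌊ x ≟ c ⌋
    fitsAt-side true  {x} cx = sym (cong not (⌊⌋-no (x ≟ c) (Adj⇒≢ {T = T} cx ∘ sym)))
    fitsAt-side false x≟c    = sym (cong not x≟c)

    fitsAt-self : ∀ x → (x ≢ c → Adj T c x) → fitsAt (not ⌊ x ≟ c ⌋) x ≡ true
    fitsAt-self x leaf⇒adj with x ≟ c
    ... | yes x≡c = ⌊⌋-yes (x ≟ c) x≡c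
    ... | no  x≢c = leaf⇒adj x≢c

    fitsAt-edge : ∀ {b b′ x y} → b ≢ b′ → fitsAt b x ≡ true → fitsAt b′ y ≡ true → Adj T x y
    fitsAt-edge {true}  {false} _    cx  y≟c =
      subst (Adj T _) (sym (⌊⌋-true⇒ (_ ≟ c) y≟c)) (Adj-sym {T = T} cx)
    fitsAt-edge {false} {true}  _    x≟c cy  =
      subst (λ z → Adj T z _) (sym (⌊⌋-true⇒ (_ ≟ c) x≟c)) cy
    fitsAt-edge {true}  {true}  b≢b′ _   _   = ⊥-elim (b≢b′ refl)
    fitsAt-edge {false} {false} b≢b′ _   _   = ⊥-elim (b≢b′ refl)

    fits⇒hom : ∀ {σ f} → Fits σ f → IsHom G T f
    fits⇒hom {σ} F {u} {v} uv = fitsAt-edge leaves-differ (F u) (F v)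
      where
      same-component : comp C u ≡ comp C v
      same-component = Equivalence.from (correct C u v) (1 , uv ∷ [])
      leaves-differ : leaf σ u ≢ leaf σ v
      leaves-differ e = proj₂ bG u v uv (xor-cancelˡ (bit (σ (comp C v)))
        (trans (cong (λ i → bit (σ i) xor col u) (sym same-component)) e))

    leafSide : (Fin n → Fin m) → Fin n → Bool
    leafSide f v = not ⌊ f v ≟ c ⌋ xor col v

    orientation : (Fin n → Fin m) → Fin K → Fin 2
    orientation f i = unbit (leafSide f (rep i))

    fits⇒orientation : ∀ {σ f} → Fits σ f → ∀ i → σ i ≡ orientation f i
    fits⇒orientation {σ} {f} F i = begin
      σ i                               ≡⟨ cong σ (proj₂ (surj C i)) ⟨
      σ (comp C (rep i))                ≡⟨ unbit-bit _ ⟨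
      unbit (bit (σ (comp C (rep i))))  ≡⟨ cong unbit (xor-solveʳ (fitsAt-side _ (F (rep i)))) ⟩
      orientation f i                   ∎
      where open ≡-Reasoning

    module _ {f : Fin n → Fin m} (hom : IsHom G T f) where

      leafSide-edge : ∀ {u v} → Adj G u v → leafSide f u ≡ leafSide f v
      leafSide-edge {u} {v} uv = begin
        not ⌊ f u ≟ c ⌋ xor col u
          ≡⟨ xor-annihilates-not (not ⌊ f u ≟ c ⌋) (col u) ⟨
        not (not ⌊ f u ≟ c ⌋) xor not (col u)
          ≡⟨ cong₂ (λ a b → not a xor b) (sym (centred-edge {T = T} centred (hom uv)))
                                         (sym (¬-not (proj₂ bG u v uv ∘ sym))) ⟩
        not ⌊ f v ≟ c ⌋ xor col v ∎
        where open ≡-Reasoning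

      leafSide-walk : ∀ {u v ℓ} → Walk G u v ℓ → leafSide f u ≡ leafSide f v
      leafSide-walk []      = refl
      leafSide-walk (e ∷ w) = trans (leafSide-edge e) (leafSide-walk w)

      leaf-orientation : ∀ v → leaf (orientation f) v ≡ not ⌊ f v ≟ c ⌋
      leaf-orientation v = begin
        bit (orientation f (comp C v)) xor col v  ≡⟨ cong (_xor col v) (bit-unbit (leafSide f (rep (comp C v)))) ⟩
        leafSide f (rep (comp C v)) xor col v     ≡⟨ cong (_xor col v) (leafSide-walk walk) ⟨
        leafSide f v xor col v                    ≡⟨ xor-solveʳ refl ⟨
        not ⌊ f v ≟ c ⌋                           ∎
        where
        open ≡-Reasoning
        walk = proj₂ (Equivalence.to (correct C v (rep (comp C v))) (sym (proj₂ (surj C (comp C v)))))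

      leaf-adjacent : ∀ v → f v ≢ c → Adj T c (f v)
      leaf-adjacent v fv≢c with nontrivial v
      ... | u , u≢v , (zero , [])     = ⊥-elim (u≢v refl)
      ... | u , _ , (suc _ , vw ∷ _) with centred _ _ (hom vw)
      ...   | inj₁ fv≡c = ⊥-elim (fv≢c fv≡c)
      ...   | inj₂ fw≡c = subst (λ z → Adj T z (f v)) fw≡c (Adj-sym {T = T} (hom vw))

      hom⇒fits : Fits (orientation f) f
      hom⇒fits v =
        subst (λ b → fitsAt b (f v) ≡ true) (sym (leaf-orientation v)) (fitsAt-self (f v) (leaf-adjacent v))

      fits⇔orientation : ∀ σ → Fits σ f ⇔ (∀ i → ⌊ σ i ≟ orientation f i ⌋ ≡ true)
      fits⇔orientation σ = mk⇔
        (λ F i → ⌊⌋-yes (σ i ≟ _) (fits⇒orientation {σ} {f} F i))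
        (λ σ≗τ v → subst (λ y → fitsAt (bit y xor col v) (f v) ≡ true)
                         (sym (⌊⌋-true⇒ (σ (comp C v) ≟ _) (σ≗τ (comp C v)))) (hom⇒fits v))

      hom-fits-once : sum (map (λ σ → ∏ (𝟙 ∘ fitsᵇ σ f)) (allFuns K 2)) ≡ 1
      hom-fits-once = begin
        sum (map (λ σ → ∏ (𝟙 ∘ fitsᵇ σ f)) (allFuns K 2))
          ≡⟨ cong sum (map-cong (λ σ → ∏-𝟙-cong (fitsᵇ σ f) _ (fits⇔orientation σ)) (allFuns K 2)) ⟩
        sum (map (λ σ → ∏ λ i → 𝟙 ⌊ σ i ≟ τ i ⌋) (allFuns K 2))
          ≡⟨ sum-allFuns-∏ K 2 (λ i y → 𝟙 ⌊ y ≟ τ i ⌋) ⟩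
        (∏ λ i → ∑[ y < 2 ] 𝟙 ⌊ y ≟ τ i ⌋)
          ≡⟨ ∏-cong {K} (λ i → ∑-𝟙-≟ (τ i)) ⟩
        (∏ {K} λ _ → 1)
          ≡⟨ ∏-𝟙-all {K} (λ _ → true) (λ _ → refl) ⟩
        1 ∎
        where
        open ≡-Reasoning
        τ = orientation f

    ¬hom-fits-none : ∀ {f} → ¬ IsHom G T f → sum (map (λ σ → ∏ (𝟙 ∘ fitsᵇ σ f)) (allFuns K 2)) ≡ 0
    ¬hom-fits-none {f} ¬hom = sum-map-≡0 (λ σ → ∏-𝟙-¬all (fitsᵇ σ f) (¬hom ∘ fits⇒hom {σ} {f})) (allFuns K 2)

    hom-indicator : ∀ f → 𝟙 (isHomᵇ G T f) ≡ sum (map (λ σ → ∏ (𝟙 ∘ fitsᵇ σ f)) (allFuns K 2))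
    hom-indicator f with isHomᵇ G T f in isHom?
    ... | true  = sym (hom-fits-once (isHomᵇ-sound G T f isHom?))
    ... | false = sym (¬hom-fits-none λ hom → case trans (sym (isHomᵇ-complete G T f hom)) isHom? of λ ())

    ∏-∑-fitsAt : ∀ σ → (∏ λ v → ∑[ x < m ] 𝟙 (fitsAt (leaf σ v) x)) ≡ ∏ λ i → s ^ leaves i (σ i)
    ∏-∑-fitsAt σ = begin
      (∏ λ v → ∑[ x < m ] 𝟙 (fitsAt (leaf σ v) x))  ≡⟨ ∏-cong (λ v → ∑-fitsAt (leaf σ v)) ⟩
      (∏ λ v → s ^ 𝟙 (leaf σ v))                     ≡⟨ ∏-pow s (𝟙 ∘ leaf σ) ⟩
      s ^ ∑[ v < n ] 𝟙 (leaf σ v)                    ≡⟨ cong (s ^_) (∑-leaf σ) ⟩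
      s ^ ∑[ i < K ] leaves i (σ i)                  ≡⟨ ∏-pow s (λ i → leaves i (σ i)) ⟨
      (∏ λ i → s ^ leaves i (σ i))                   ∎
      where open ≡-Reasoning

    homCount-centred : homCount G T ≡ powerSum s (exponents (sumM bG C) (dVec bG C))
    homCount-centred = begin
      length (filterᵇ (isHomᵇ G T) (allFuns n m))
        ≡⟨ length-filterᵇ (isHomᵇ G T) (allFuns n m) ⟩
      sum (map (𝟙 ∘ isHomᵇ G T) (allFuns n m))
        ≡⟨ cong sum (map-cong hom-indicator (allFuns n m)) ⟩
      sum (map (λ f → sum (map (λ σ → ∏ (𝟙 ∘ fitsᵇ σ f)) (allFuns K 2))) (allFuns n m))
        ≡⟨ sum-map-comm (λ f σ → ∏ (𝟙 ∘ fitsᵇ σ f)) (allFuns n m) (allFuns K 2) ⟩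
      sum (map (λ σ → sum (map (λ f → ∏ (𝟙 ∘ fitsᵇ σ f)) (allFuns n m))) (allFuns K 2))
        ≡⟨ cong sum (map-cong (λ σ → trans (sum-allFuns-∏ n m (λ v → 𝟙 ∘ fitsAt (leaf σ v))) (∏-∑-fitsAt σ))
                              (allFuns K 2)) ⟩
      sum (map (λ σ → ∏ λ i → s ^ leaves i (σ i)) (allFuns K 2))
        ≡⟨ sum-allFuns-∏ K 2 (λ i y → s ^ leaves i y) ⟩
      (∏ λ i → s ^ leaves i 0F + (s ^ leaves i 1F + 0))
        ≡⟨ ∏-cong (λ i → cong (s ^ leaves i 0F +_) (+-identityʳ (s ^ leaves i 1F))) ⟩
      (∏ λ i → s ^ leaves i 0F + s ^ leaves i 1F)
        ≡⟨ ∏-^-+ s (λ i → leaves i 0F) (λ i → leaves i 1F) ⟩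
      s ^ sumM bG C * powerSum s (psum (dVec bG C))
        ≡⟨ powerSum-shift s (sumM bG C) (psum (dVec bG C)) ⟨
      powerSum s (exponents (sumM bG C) (dVec bG C)) ∎
      where open ≡-Reasoning

  homCount-star : ∀ s → homCount G (Star s) ≡ powerSum s (exponents (sumM bG C) (dVec bG C))
  homCount-star s = trans (homCount-centred {T = Star s} star-centred)
                          (cong (λ d → powerSum d (exponents (sumM bG C) (dVec bG C))) (star-degree s))

theorem9 : ∀ {nG nH} (G : Graph nG) (H : Graph nH)
    (bG : Bipartite G) (bH : Bipartite H)
    → ComponentsAtLeastTwo G → ComponentsAtLeastTwo H
    → (cG : Components G) (cH : Components H)
    → ((∀ (t : ℕ) (T : Graph (suc t)) → IsTree T → DiameterAtMost 2 T → homCount G T ≡ homCount H T)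
       ⇔ ((γ cG ≡ γ cH) × (sumM bG cG ≡ sumM bH cH) × (psum (dVec bG cG) ↭ psum (dVec bH cH))))
theorem9 G H bG bH twoG twoH cG cH = mk⇔ same-invariants same-counts
  where
  same-invariants = λ hyp →
    let |dG|≡|dH| , M≡ , P↭ = exponents-injective (dVec bG cG) (dVec bH cH) (powerSum-injective λ s →
          trans (sym (homCount-star bG twoG cG s))
                (trans (hyp s (Star s) (star-tree s) (star-diameter s)) (homCount-star bH twoH cH s)))
    in trans (sym (length-tabulate _)) (trans |dG|≡|dH| (length-tabulate _)) , M≡ , P↭

  same-counts = λ (_ , M≡ , P↭) t T tree diam →
    let c , centred = tree-diameter≤2⇒centred tree diam
    in trans (homCount-centred bG twoG cG {T = T} centred)
             (trans (powerSum-↭ (countᵇ (adj T c)) (exponents-cong (dVec bG cG) (dVec bH cH) M≡ P↭))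
                    (sym (homCount-centred bH twoH cH {T = T} centred)))
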